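{- Let $n,m\ge0$ be integers and $b_2\in\mathbb C$. Write $U_{n,m}(b_1,b_2):=U^{(0)}_{n,m}(z,w;-4b_1^2,-4b_2^2)$ (generalized Umemura polynomial with $k=0$, defined in the context). Let $[n;m]_{\rm odd}=\{i\in[n;m]: i\text{ odd}\}$ and let $b_{[n;m]_{\rm odd}}=\prod_{i\in[n;m]_{\rm odd}}b_i$ be computed with parameter $b=-4b_2^2$. Then $$U_{n,m}(0,b_2)=\begin{cases} b_{[n;m]_{\rm odd}}\,w^{(n/2)^2}\,U_{0,\,m+\frac n2}\!\left(\tfrac n2,b_2\right), & n\text{ even},\\[4pt] b_{[n;m]_{\rm odd}}\,w^{\left(\frac{n+2m+1}{2}\right)^2}\,U_{0,\,\frac{n-1}{2}}\!\left(m+\tfrac{n+1}{2},b_2\right), & n\text{ odd}.\end{cases}$$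
   Context: For integers $n,m\ge 0$ let $[n;m]=\{1,2,\dots,n,\,n+2,n+4,\dots,n+2m\}$. For $I\subset[n;m]$ put $\mathbf d_{n,m}(I)=\prod_{i\in I,\ j\in[n;m]\setminus I}\left|\frac{i+j}{i-j}\right|$, $\mathbf c(I)=\sum_{i\in I,\ i>n}\frac{i-n}{2}$, and $|I|=\sum_{i\in I}i$ (sum of elements). For complex parameters $a,b$ set $\bar a_j=a+(j-1)^2$, $a_{2j}=\bar a_2\bar a_4\cdots\bar a_{2j}$, $a_{2j+1}=\bar a_1\bar a_3\cdots\bar a_{2j+1}$, and likewise $\bar b_j=b+(j-1)^2$, $b_{2j}=\bar b_2\cdots\bar b_{2j}$, $b_{2j+1}=\bar b_1\bar b_3\cdots\bar b_{2j+1}$; for a set $I$, $a_I=\prod_{i\in I}a_i$, $b_I=\prod_{i\in I}b_i$. The generalized Umemura polynomial with $k=0$ is $$U^{(0)}_{n,m}(z,w;a,b)=\sum_{I\subset[n;m]}\mathbf d_{n,m}(I)\,(-1)^{\mathbf c(I)}\,a_I\,b_{[n;m]\setminus I}\,z^{|I|}\,w^{|[n;m]\setminus I|},$$ a polynomial in the variables $z,w$. Thus $U_{0,j}(\beta_1,b_2)$ means $U^{(0)}_{0,j}(z,w;-4\beta_1^2,-4b_2^2)$. -}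

module Defs where

open import Level using (Level; 0ℓ)
open import Data.Nat as ℕ using (ℕ; zero; suc; _∸_; _<ᵇ_)
open import Data.Nat.DivMod using (_/_; _%_)
open import Data.Integer as ℤ using (ℤ; +_)
open import Data.Rational as ℚ using (ℚ; 0ℚ; 1ℚ)
import Data.Rational.Properties as ℚP
open import Data.Bool using (if_then_else_)
open import Data.List using (List; []; _∷_; _++_; map; concatMap; foldr; upTo; filter)
open import Data.Product using (_×_; _,_)
open import Algebra.Bundles using (CommutativeRing)
open import Algebra.Morphism.Structures using (module RingMorphisms)

-- The index set [n;m] = {1,…,n, n+2, n+4, …, n+2m} as a list (no repetitions).
nm-set : ℕ → ℕ → List ℕ
nm-set n m = map suc (upTo n) ++ map (λ k → n ℕ.+ 2 ℕ.* suc k) (upTo m)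

splits : List ℕ → List (List ℕ × List ℕ)
splits [] = ([] , []) ∷ []
splits (x ∷ xs) = concatMap (λ { (I , J) → (x ∷ I , J) ∷ (I , x ∷ J) ∷ [] }) (splits xs)

-- |a / d| for naturals a, d with d ≠ 0 (the d = 0 branch is never used,
-- since elements of I and its complement are distinct).
frac : ℕ → ℕ → ℚ
frac a zero = 0ℚ
frac a (suc d) = (+ a) ℚ./ suc d

dfac : ℕ → ℕ → ℚ
dfac i j = frac (i ℕ.+ j) (ℕ.∣ i - j ∣)

prodℚ : List ℚ → ℚ
prodℚ = foldr ℚ._*_ 1ℚ

sumℕ : List ℕ → ℕ
sumℕ = foldr ℕ._+_ 0

-- d_{n,m}(I) = ∏_{i∈I, j∈J} |(i+j)/(i-j)|, J the complement
dcoef : List ℕ → List ℕ → ℚ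
dcoef I J = prodℚ (concatMap (λ i → map (λ j → dfac i j) J) I)

ccoef : ℕ → List ℕ → ℕ
ccoef n I = sumℕ (map (λ i → if n <ᵇ i then (i ∸ n) / 2 else 0) I)

negpow : ℕ → ℚ
negpow zero = 1ℚ
negpow (suc c) = ℚ.- negpow c

-- |I| = sum of elements
size : List ℕ → ℕ
size = sumℕ

ℚring : CommutativeRing 0ℓ 0ℓ
ℚring = ℚP.+-*-commutativeRing

-- ι : ℚ → R is a unital ring homomorphism (R is a ℚ-algebra, e.g. ℂ)
IsℚAlgebraMap : ∀ {c ℓ} (R : CommutativeRing c ℓ) → (ℚ → CommutativeRing.Carrier R) → Set ℓ
IsℚAlgebraMap R ι = RingMorphisms.IsRingHomomorphism
  (CommutativeRing.rawRing ℚring) (CommutativeRing.rawRing R) ι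

module Umemura {c ℓ} (R : CommutativeRing c ℓ) (ι : ℚ → CommutativeRing.Carrier R) where
  open CommutativeRing R

  nat : ℕ → Carrier
  nat k = ι ((+ k) ℚ./ 1)

  pow : Carrier → ℕ → Carrier
  pow x zero = 1#
  pow x (suc k) = x * pow x k

  prod : List Carrier → Carrier
  prod = foldr _*_ 1#

  sum : List Carrier → Carrier
  sum = foldr _+_ 0#

  -- a_j : a_{2j} = ā_2 ā_4 ⋯ ā_{2j}, a_{2j+1} = ā_1 ā_3 ⋯ ā_{2j+1}, ā_j = a + (j-1)^2
  -- (a_0 = 1, empty product; never used since 0 ∉ [n;m])
  seqA : Carrier → ℕ → Carrier
  seqA a zero = 1#
  seqA a (suc zero) = a + nat 0
  seqA a (suc (suc k)) = (a + nat (suc k ℕ.* suc k)) * seqA a k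

  seqA-set : Carrier → List ℕ → Carrier
  seqA-set a I = prod (map (seqA a) I)

  U : ℕ → ℕ → (z w a b : Carrier) → Carrier
  U n m z w a b = sum (map term (splits (nm-set n m)))
    where
    term : List ℕ × List ℕ → Carrier
    term (I , J) = ι (dcoef I J ℚ.* negpow (ccoef n I))
                   * seqA-set a I * seqA-set b J
                   * pow z (size I) * pow w (size J)

  param : Carrier → Carrier
  param β = - (nat 4 * β * β)

  Uβ : ℕ → ℕ → (z w β₁ β₂ : Carrier) → Carrier
  Uβ n m z w β₁ β₂ = U n m z w (param β₁) (param β₂)

  odd-part : ℕ → ℕ → List ℕ
  odd-part n m = filter (λ i → i % 2 ℕ.≟ 1) (nm-set n m)

-- At b₁ = 0 the parameter a vanishes, hence so does a_i for every odd i, whose first factor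
-- is ā₁ = a. So only subsets I of even elements contribute: the odd elements 1, 3, …, 2P−1
-- of [n;m] all lie in the complement, giving b_{[n;m]odd} w^(P²), and their cross factors
-- |(i+j)/(i−j)| attach to each even i. For i = 2k they turn (−1)^c(i) a_{2k}(0) into
-- (−1)^k a_{2k}(−4P²), by induction on P from a_{2k}(−4(x+1)²)(2x+1−2k) = a_{2k}(−4x²)(2x+2k+1).
-- The even elements of [n;m] are 2, 4, …, 2M, so what remains is U_{0,M}(P, b₂), where
-- (P, M) = (p, p+m) for n = 2p and (p+m+1, p) for n = 2p+1.
module Submission where

open import Defs
open import Level using (0ℓ)
open import Function using (_∘_; id)
open import Data.Bool using (true; false; T; if_then_else_)
open import Data.Empty using (⊥-elim)
open import Data.Product using (_×_; _,_)
open import Data.Nat as ℕ using (ℕ; zero; suc; _∸_; _<_; _≤?_; _<ᵇ_; ∣_-_∣)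
import Data.Nat.Properties as ℕP
open import Data.Nat.DivMod using (_/_; _%_; m*n%n≡0; [m+kn]%n≡m%n; m*n/n≡m)
open import Data.Nat.ListAction.Properties using (sum-++)
open import Data.Nat.Tactic.RingSolver using (solve-∀)
open import Data.Integer as ℤ using (+_)
import Data.Integer.Properties as ℤP
open import Data.Integer.Solver using () renaming (module +-*-Solver to ℤ-Solver)
import Data.Rational as ℚ
open import Data.Rational using (ℚ; 0ℚ; 1ℚ; toℚᵘ)
import Data.Rational.Properties as ℚP
open import Data.Rational.Solver using () renaming (module +-*-Solver to ℚ-Solver)
open import Data.Rational.Unnormalised as ℚᵘ using (mkℚᵘ; *≡*) renaming (_≃_ to _≃ᵘ_)
import Data.Rational.Unnormalised.Properties as ℚᵘP
open import Data.List using (List; []; _∷_; _++_; map; concatMap; applyUpTo; upTo; filter)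
import Data.List.Properties as LP
open import Data.List.Relation.Unary.All as All using (All; []; _∷_)
open import Data.List.Relation.Unary.All.Properties using (applyUpTo⁺₁; applyUpTo⁺₂; map⁺)
open import Relation.Nullary using (¬_; yes; no)
open import Relation.Unary using (Pred; Decidable; ∁)
open import Relation.Unary.Properties using (∁?)
open import Relation.Binary.PropositionalEquality using (_≡_; _≢_; refl; sym; trans; cong; cong₂; subst; module ≡-Reasoning)
open import Algebra.Bundles using (CommutativeRing)
open import Algebra.Morphism.Structures using (module RingMorphisms)

-- ℕ inside ℚ

fromℕ : ℕ → ℚ
fromℕ n = + n ℚ./ 1

toℚᵘ-frac : ∀ a d → toℚᵘ (frac a (suc d)) ≃ᵘ mkℚᵘ (+ a) d
toℚᵘ-frac a d = ℚP.toℚᵘ-fromℚᵘ (mkℚᵘ (+ a) d)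

toℚᵘ-fromℕ : ∀ n → toℚᵘ (fromℕ n) ≃ᵘ mkℚᵘ (+ n) 0
toℚᵘ-fromℕ n = toℚᵘ-frac n 0

fromℕ-+ : ∀ m n → fromℕ (m ℕ.+ n) ≡ fromℕ m ℚ.+ fromℕ n
fromℕ-+ m n = ℚP.toℚᵘ-injective (begin
  toℚᵘ (fromℕ (m ℕ.+ n))               ≈⟨ toℚᵘ-fromℕ (m ℕ.+ n) ⟩
  mkℚᵘ (+ (m ℕ.+ n)) 0                 ≈⟨ *≡* ℤ-identity ⟩
  mkℚᵘ (+ m) 0 ℚᵘ.+ mkℚᵘ (+ n) 0       ≈⟨ ℚᵘP.+-cong (toℚᵘ-fromℕ m) (toℚᵘ-fromℕ n) ⟨
  toℚᵘ (fromℕ m) ℚᵘ.+ toℚᵘ (fromℕ n)   ≈⟨ ℚP.toℚᵘ-homo-+ (fromℕ m) (fromℕ n) ⟨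
  toℚᵘ (fromℕ m ℚ.+ fromℕ n)           ∎)
  where
  open ℚᵘP.≃-Reasoning
  open ℤ-Solver
  ℤ-identity : + (m ℕ.+ n) ℤ.* + 1 ≡ (+ m ℤ.* + 1 ℤ.+ + n ℤ.* + 1) ℤ.* + 1
  ℤ-identity rewrite ℤP.pos-+ m n =
    solve 2 (λ x y → (x :+ y) :* con (+ 1) := (x :* con (+ 1) :+ y :* con (+ 1)) :* con (+ 1)) refl (+ m) (+ n)

fromℕ-* : ∀ m n → fromℕ (m ℕ.* n) ≡ fromℕ m ℚ.* fromℕ n
fromℕ-* m n = ℚP.toℚᵘ-injective (begin
  toℚᵘ (fromℕ (m ℕ.* n))               ≈⟨ toℚᵘ-fromℕ (m ℕ.* n) ⟩
  mkℚᵘ (+ (m ℕ.* n)) 0                 ≈⟨ *≡* (cong (ℤ._* + 1) (ℤP.pos-* m n)) ⟩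
  mkℚᵘ (+ m) 0 ℚᵘ.* mkℚᵘ (+ n) 0       ≈⟨ ℚᵘP.*-cong (toℚᵘ-fromℕ m) (toℚᵘ-fromℕ n) ⟨
  toℚᵘ (fromℕ m) ℚᵘ.* toℚᵘ (fromℕ n)   ≈⟨ ℚP.toℚᵘ-homo-* (fromℕ m) (fromℕ n) ⟨
  toℚᵘ (fromℕ m ℚ.* fromℕ n)           ∎)
  where open ℚᵘP.≃-Reasoning

fromℕ-2* : ∀ n → fromℕ (2 ℕ.* n) ≡ fromℕ n ℚ.+ fromℕ n
fromℕ-2* n = trans (cong (λ k → fromℕ (n ℕ.+ k)) (ℕP.+-identityʳ n)) (fromℕ-+ n n)

fromℕ-1+2* : ∀ n → fromℕ (suc (2 ℕ.* n)) ≡ 1ℚ ℚ.+ (fromℕ n ℚ.+ fromℕ n)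
fromℕ-1+2* n = trans (fromℕ-+ 1 (2 ℕ.* n)) (cong (1ℚ ℚ.+_) (fromℕ-2* n))

frac-*-fromℕ : ∀ a d → d ≢ 0 → frac a d ℚ.* fromℕ d ≡ fromℕ a
frac-*-fromℕ a zero d≢0 = ⊥-elim (d≢0 refl)
frac-*-fromℕ a (suc d) _ = ℚP.toℚᵘ-injective (begin
  toℚᵘ (frac a (suc d) ℚ.* fromℕ (suc d))           ≈⟨ ℚP.toℚᵘ-homo-* (frac a (suc d)) (fromℕ (suc d)) ⟩
  toℚᵘ (frac a (suc d)) ℚᵘ.* toℚᵘ (fromℕ (suc d))   ≈⟨ ℚᵘP.*-cong (toℚᵘ-frac a d) (toℚᵘ-fromℕ (suc d)) ⟩
  mkℚᵘ (+ a) d ℚᵘ.* mkℚᵘ (+ suc d) 0                ≈⟨ *≡* (ℤP.*-assoc (+ a) (+ suc d) (+ 1)) ⟩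
  mkℚᵘ (+ a) 0                                      ≈⟨ toℚᵘ-fromℕ a ⟨
  toℚᵘ (fromℕ a)                                    ∎)
  where open ℚᵘP.≃-Reasoning

*-cancelʳ-fromℕ : ∀ {x y} d → d ≢ 0 → x ℚ.* fromℕ d ≡ y ℚ.* fromℕ d → x ≡ y
*-cancelʳ-fromℕ {x} {y} d d≢0 eq = begin
  x                                ≡⟨ ℚP.*-identityʳ x ⟨
  x ℚ.* 1ℚ                         ≡⟨ cong (x ℚ.*_) inverse ⟨
  x ℚ.* (fromℕ d ℚ.* frac 1 d)     ≡⟨ ℚP.*-assoc x (fromℕ d) (frac 1 d) ⟨
  x ℚ.* fromℕ d ℚ.* frac 1 d       ≡⟨ cong (ℚ._* frac 1 d) eq ⟩
  y ℚ.* fromℕ d ℚ.* frac 1 d       ≡⟨ ℚP.*-assoc y (fromℕ d) (frac 1 d) ⟩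
  y ℚ.* (fromℕ d ℚ.* frac 1 d)     ≡⟨ cong (y ℚ.*_) inverse ⟩
  y ℚ.* 1ℚ                         ≡⟨ ℚP.*-identityʳ y ⟩
  y                                ∎
  where
  open ≡-Reasoning
  inverse : fromℕ d ℚ.* frac 1 d ≡ 1ℚ
  inverse = trans (ℚP.*-comm (fromℕ d) (frac 1 d)) (frac-*-fromℕ 1 d d≢0)

frac-2* : ∀ n → frac (2 ℕ.* n) 2 ≡ fromℕ n
frac-2* n = *-cancelʳ-fromℕ 2 (λ ()) (begin
  frac (2 ℕ.* n) 2 ℚ.* fromℕ 2   ≡⟨ frac-*-fromℕ (2 ℕ.* n) 2 (λ ()) ⟩
  fromℕ (2 ℕ.* n)                ≡⟨ cong fromℕ (ℕP.*-comm 2 n) ⟩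
  fromℕ (n ℕ.* 2)                ≡⟨ fromℕ-* n 2 ⟩
  fromℕ n ℚ.* fromℕ 2            ∎)
  where open ≡-Reasoning

negpow-+ : ∀ a b → negpow (a ℕ.+ b) ≡ negpow a ℚ.* negpow b
negpow-+ zero b = sym (ℚP.*-identityˡ (negpow b))
negpow-+ (suc a) b = trans (cong ℚ.-_ (negpow-+ a b)) (ℚP.neg-distribˡ-* (negpow a) (negpow b))

negpow²≡1 : ∀ n → negpow n ℚ.* negpow n ≡ 1ℚ
negpow²≡1 zero = refl
negpow²≡1 (suc n) = trans (solve 1 (λ x → (:- x) :* (:- x) := x :* x) refl (negpow n)) (negpow²≡1 n)
  where open ℚ-Solver

prodℚ-++ : ∀ xs ys → prodℚ (xs ++ ys) ≡ prodℚ xs ℚ.* prodℚ ys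
prodℚ-++ [] ys = sym (ℚP.*-identityˡ (prodℚ ys))
prodℚ-++ (x ∷ xs) ys = trans (cong (x ℚ.*_) (prodℚ-++ xs ys)) (sym (ℚP.*-assoc x (prodℚ xs) (prodℚ ys)))

-- The coefficients a₂ₖ(−4x²)

module Uℚ = Umemura ℚring (λ q → q)

seqA-even : ℚ → ℕ → ℚ
seqA-even x k = Uℚ.seqA (Uℚ.param x) (2 ℕ.* k)

seqA-2*suc : ∀ a k → let O = 1ℚ ℚ.+ (fromℕ k ℚ.+ fromℕ k) in
  Uℚ.seqA a (2 ℕ.* suc k) ≡ (a ℚ.+ O ℚ.* O) ℚ.* Uℚ.seqA a (2 ℕ.* k)
seqA-2*suc a k = begin
  Uℚ.seqA a (2 ℕ.* suc k)
    ≡⟨ cong (Uℚ.seqA a) (ℕP.*-suc 2 k) ⟩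
  (a ℚ.+ fromℕ (suc (2 ℕ.* k) ℕ.* suc (2 ℕ.* k))) ℚ.* Uℚ.seqA a (2 ℕ.* k)
    ≡⟨ cong (λ t → (a ℚ.+ t) ℚ.* Uℚ.seqA a (2 ℕ.* k))
            (trans (fromℕ-* (suc (2 ℕ.* k)) (suc (2 ℕ.* k))) (cong₂ ℚ._*_ (fromℕ-1+2* k) (fromℕ-1+2* k))) ⟩
  (a ℚ.+ (1ℚ ℚ.+ (fromℕ k ℚ.+ fromℕ k)) ℚ.* (1ℚ ℚ.+ (fromℕ k ℚ.+ fromℕ k))) ℚ.* Uℚ.seqA a (2 ℕ.* k) ∎
  where open ≡-Reasoning

seqA-even-shift : ∀ x k → let K = fromℕ k in
  seqA-even (1ℚ ℚ.+ x) k ℚ.* (1ℚ ℚ.+ (x ℚ.+ x) ℚ.- (K ℚ.+ K))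
    ≡ seqA-even x k ℚ.* ((K ℚ.+ K) ℚ.+ (x ℚ.+ x) ℚ.+ 1ℚ)
seqA-even-shift x zero =
  solve 1 (λ x → con 1ℚ :* (con 1ℚ :+ (x :+ x) :- (con 0ℚ :+ con 0ℚ))
               := con 1ℚ :* ((con 0ℚ :+ con 0ℚ) :+ (x :+ x) :+ con 1ℚ)) refl x
  where open ℚ-Solver
-- Both solver steps rest on (2k+1)² − 4y² = (2k+1−2y)(2k+1+2y), for y = x+1 and y = x.
seqA-even-shift x (suc k) = begin
  seqA-even (1ℚ ℚ.+ x) (suc k) ℚ.* (1ℚ ℚ.+ (x ℚ.+ x) ℚ.- (fromℕ (suc k) ℚ.+ fromℕ (suc k)))
    ≡⟨ cong₂ (λ s K′ → s ℚ.* (1ℚ ℚ.+ (x ℚ.+ x) ℚ.- (K′ ℚ.+ K′)))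
             (seqA-2*suc (Uℚ.param (1ℚ ℚ.+ x)) k) (fromℕ-+ 1 k) ⟩
  (Uℚ.param (1ℚ ℚ.+ x) ℚ.+ O ℚ.* O) ℚ.* Q₁ ℚ.* (1ℚ ℚ.+ (x ℚ.+ x) ℚ.- ((1ℚ ℚ.+ K) ℚ.+ (1ℚ ℚ.+ K)))
    ≡⟨ solve 3 (λ K x q → (:- (con (fromℕ 4) :* (con 1ℚ :+ x) :* (con 1ℚ :+ x)) :+ (con 1ℚ :+ (K :+ K)) :* (con 1ℚ :+ (K :+ K)))
                              :* q :* (con 1ℚ :+ (x :+ x) :- ((con 1ℚ :+ K) :+ (con 1ℚ :+ K)))
                           := ((con 1ℚ :+ (K :+ K)) :- (x :+ x)) :* ((K :+ K) :+ (x :+ x) :+ con 1ℚ :+ con 1ℚ :+ con 1ℚ)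
                              :* (q :* (con 1ℚ :+ (x :+ x) :- (K :+ K)))) refl K x Q₁ ⟩
  c ℚ.* (Q₁ ℚ.* (1ℚ ℚ.+ (x ℚ.+ x) ℚ.- (K ℚ.+ K)))
    ≡⟨ cong (c ℚ.*_) (seqA-even-shift x k) ⟩
  c ℚ.* (Q₀ ℚ.* ((K ℚ.+ K) ℚ.+ (x ℚ.+ x) ℚ.+ 1ℚ))
    ≡⟨ solve 3 (λ K x q → ((con 1ℚ :+ (K :+ K)) :- (x :+ x)) :* ((K :+ K) :+ (x :+ x) :+ con 1ℚ :+ con 1ℚ :+ con 1ℚ)
                              :* (q :* ((K :+ K) :+ (x :+ x) :+ con 1ℚ))
                           := (:- (con (fromℕ 4) :* x :* x) :+ (con 1ℚ :+ (K :+ K)) :* (con 1ℚ :+ (K :+ K)))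
                              :* q :* (((con 1ℚ :+ K) :+ (con 1ℚ :+ K)) :+ (x :+ x) :+ con 1ℚ)) refl K x Q₀ ⟩
  (Uℚ.param x ℚ.+ O ℚ.* O) ℚ.* Q₀ ℚ.* (((1ℚ ℚ.+ K) ℚ.+ (1ℚ ℚ.+ K)) ℚ.+ (x ℚ.+ x) ℚ.+ 1ℚ)
    ≡⟨ cong₂ (λ s K′ → s ℚ.* ((K′ ℚ.+ K′) ℚ.+ (x ℚ.+ x) ℚ.+ 1ℚ))
             (seqA-2*suc (Uℚ.param x) k) (fromℕ-+ 1 k) ⟨
  seqA-even x (suc k) ℚ.* ((fromℕ (suc k) ℚ.+ fromℕ (suc k)) ℚ.+ (x ℚ.+ x) ℚ.+ 1ℚ) ∎
  where
  open ≡-Reasoning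
  open ℚ-Solver
  K = fromℕ k
  O = 1ℚ ℚ.+ (K ℚ.+ K)
  Q₀ = seqA-even x k
  Q₁ = seqA-even (1ℚ ℚ.+ x) k
  c = ((1ℚ ℚ.+ (K ℚ.+ K)) ℚ.- (x ℚ.+ x)) ℚ.* ((K ℚ.+ K) ℚ.+ (x ℚ.+ x) ℚ.+ 1ℚ ℚ.+ 1ℚ ℚ.+ 1ℚ)

negpow-∣2k-[2P+1]∣ : ∀ k P →
  negpow (k ∸ P) ℚ.* fromℕ ∣ 2 ℕ.* k - suc (2 ℕ.* P) ∣
    ≡ negpow (k ∸ suc P) ℚ.* (1ℚ ℚ.+ (fromℕ P ℚ.+ fromℕ P) ℚ.- (fromℕ k ℚ.+ fromℕ k))
negpow-∣2k-[2P+1]∣ k P with k ≤? P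
... | yes k≤P with (r , refl) ← ℕP.m≤n⇒∃[o]m+o≡n k≤P = begin
  negpow (k ∸ (k ℕ.+ r)) ℚ.* fromℕ ∣ 2 ℕ.* k - suc (2 ℕ.* (k ℕ.+ r)) ∣
    ≡⟨ cong₂ (λ e d → negpow e ℚ.* d) (ℕP.m≤n⇒m∸n≡0 k≤P) (trans (cong fromℕ distance) (fromℕ-1+2* r)) ⟩
  1ℚ ℚ.* (1ℚ ℚ.+ (R ℚ.+ R))
    ≡⟨ solve 2 (λ K R → con 1ℚ :* (con 1ℚ :+ (R :+ R))
                     := con 1ℚ :* (con 1ℚ :+ ((K :+ R) :+ (K :+ R)) :- (K :+ K))) refl K R ⟩
  1ℚ ℚ.* (1ℚ ℚ.+ ((K ℚ.+ R) ℚ.+ (K ℚ.+ R)) ℚ.- (K ℚ.+ K))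
    ≡⟨ cong₂ (λ e P′ → negpow e ℚ.* (1ℚ ℚ.+ (P′ ℚ.+ P′) ℚ.- (K ℚ.+ K)))
             (ℕP.m≤n⇒m∸n≡0 (ℕP.m≤n⇒m≤1+n k≤P)) (fromℕ-+ k r) ⟨
  negpow (k ∸ suc (k ℕ.+ r)) ℚ.* (1ℚ ℚ.+ (fromℕ (k ℕ.+ r) ℚ.+ fromℕ (k ℕ.+ r)) ℚ.- (K ℚ.+ K)) ∎
  where
  open ≡-Reasoning
  open ℚ-Solver
  K = fromℕ k
  R = fromℕ r
  split : ∀ k r → suc (2 ℕ.* (k ℕ.+ r)) ≡ 2 ℕ.* k ℕ.+ suc (2 ℕ.* r)
  split = solve-∀
  distance : ∣ 2 ℕ.* k - suc (2 ℕ.* (k ℕ.+ r)) ∣ ≡ suc (2 ℕ.* r)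
  distance = trans (cong (∣ 2 ℕ.* k -_∣) (split k r)) (ℕP.∣m-m+n∣≡n (2 ℕ.* k) (suc (2 ℕ.* r)))
... | no k≰P with (r , refl) ← ℕP.m≤n⇒∃[o]m+o≡n (ℕP.≰⇒> k≰P) = begin
  negpow (suc (P ℕ.+ r) ∸ P) ℚ.* fromℕ ∣ 2 ℕ.* suc (P ℕ.+ r) - suc (2 ℕ.* P) ∣
    ≡⟨ cong₂ (λ e d → negpow e ℚ.* d) exponent (trans (cong fromℕ distance) (fromℕ-1+2* r)) ⟩
  ℚ.- negpow r ℚ.* (1ℚ ℚ.+ (R ℚ.+ R))
    ≡⟨ solve 3 (λ s P R → (:- s) :* (con 1ℚ :+ (R :+ R))
                       := s :* (con 1ℚ :+ (P :+ P) :- ((con 1ℚ :+ (P :+ R)) :+ (con 1ℚ :+ (P :+ R))))) refl (negpow r) X R ⟩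
  negpow r ℚ.* (1ℚ ℚ.+ (X ℚ.+ X) ℚ.- ((1ℚ ℚ.+ (X ℚ.+ R)) ℚ.+ (1ℚ ℚ.+ (X ℚ.+ R))))
    ≡⟨ cong₂ (λ e K → negpow e ℚ.* (1ℚ ℚ.+ (X ℚ.+ X) ℚ.- (K ℚ.+ K)))
             (ℕP.m+n∸m≡n P r) (trans (fromℕ-+ 1 (P ℕ.+ r)) (cong (1ℚ ℚ.+_) (fromℕ-+ P r))) ⟨
  negpow (suc (P ℕ.+ r) ∸ suc P) ℚ.* (1ℚ ℚ.+ (X ℚ.+ X) ℚ.- (fromℕ (suc (P ℕ.+ r)) ℚ.+ fromℕ (suc (P ℕ.+ r)))) ∎
  where
  open ≡-Reasoning
  open ℚ-Solver
  X = fromℕ P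
  R = fromℕ r
  exponent : suc (P ℕ.+ r) ∸ P ≡ suc r
  exponent = trans (cong (_∸ P) (sym (ℕP.+-suc P r))) (ℕP.m+n∸m≡n P (suc r))
  split : ∀ P r → 2 ℕ.* suc (P ℕ.+ r) ≡ suc (2 ℕ.* P) ℕ.+ suc (2 ℕ.* r)
  split = solve-∀
  distance : ∣ 2 ℕ.* suc (P ℕ.+ r) - suc (2 ℕ.* P) ∣ ≡ suc (2 ℕ.* r)
  distance = trans (cong ∣_- suc (2 ℕ.* P) ∣ (split P r))
                   (trans (ℕP.∣-∣-comm (suc (2 ℕ.* P) ℕ.+ suc (2 ℕ.* r)) (suc (2 ℕ.* P)))
                          (ℕP.∣m-m+n∣≡n (suc (2 ℕ.* P)) (suc (2 ℕ.* r))))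

-- Multiply through by D = |2k − (2P+1)|, which is nonzero because 2k is even.
dfac-seqA-even-step : ∀ k P →
  negpow (k ∸ suc P) ℚ.* dfac (2 ℕ.* k) (suc (2 ℕ.* P)) ℚ.* seqA-even (fromℕ P) k
    ≡ negpow (k ∸ P) ℚ.* seqA-even (fromℕ (suc P)) k
dfac-seqA-even-step k P = *-cancelʳ-fromℕ D D≢0 (begin
  s₁ ℚ.* d ℚ.* Q₀ ℚ.* fromℕ D
    ≡⟨ solve 4 (λ s d q D → s :* d :* q :* D := s :* (q :* (d :* D))) refl s₁ d Q₀ (fromℕ D) ⟩
  s₁ ℚ.* (Q₀ ℚ.* (d ℚ.* fromℕ D))
    ≡⟨ cong (λ t → s₁ ℚ.* (Q₀ ℚ.* t)) (trans (frac-*-fromℕ (2 ℕ.* k ℕ.+ suc (2 ℕ.* P)) D D≢0) 2k+2P+1) ⟩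
  s₁ ℚ.* (Q₀ ℚ.* ((K ℚ.+ K) ℚ.+ (X ℚ.+ X) ℚ.+ 1ℚ))
    ≡⟨ cong (s₁ ℚ.*_) (seqA-even-shift X k) ⟨
  s₁ ℚ.* (Q₁ ℚ.* F)
    ≡⟨ solve 3 (λ s q e → s :* (q :* e) := q :* (s :* e)) refl s₁ Q₁ F ⟩
  Q₁ ℚ.* (s₁ ℚ.* F)
    ≡⟨ cong (Q₁ ℚ.*_) (negpow-∣2k-[2P+1]∣ k P) ⟨
  Q₁ ℚ.* (s₀ ℚ.* fromℕ D)
    ≡⟨ solve 3 (λ q s D → q :* (s :* D) := s :* q :* D) refl Q₁ s₀ (fromℕ D) ⟩
  s₀ ℚ.* Q₁ ℚ.* fromℕ D
    ≡⟨ cong (λ x → s₀ ℚ.* seqA-even x k ℚ.* fromℕ D) (fromℕ-+ 1 P) ⟨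
  s₀ ℚ.* seqA-even (fromℕ (suc P)) k ℚ.* fromℕ D ∎)
  where
  open ≡-Reasoning
  open ℚ-Solver
  K = fromℕ k
  X = fromℕ P
  F = 1ℚ ℚ.+ (X ℚ.+ X) ℚ.- (K ℚ.+ K)
  D = ∣ 2 ℕ.* k - suc (2 ℕ.* P) ∣
  D≢0 : D ≢ 0
  D≢0 D≡0 = ℕP.even≢odd k P (ℕP.∣m-n∣≡0⇒m≡n D≡0)
  s₀ = negpow (k ∸ P)
  s₁ = negpow (k ∸ suc P)
  d = dfac (2 ℕ.* k) (suc (2 ℕ.* P))
  Q₀ = seqA-even X k
  Q₁ = seqA-even (1ℚ ℚ.+ X) k
  2k+2P+1 : fromℕ (2 ℕ.* k ℕ.+ suc (2 ℕ.* P)) ≡ (K ℚ.+ K) ℚ.+ (X ℚ.+ X) ℚ.+ 1ℚ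
  2k+2P+1 = trans (fromℕ-+ (2 ℕ.* k) (suc (2 ℕ.* P)))
                  (trans (cong₂ ℚ._+_ (fromℕ-2* k) (fromℕ-1+2* P))
                         (solve 2 (λ K X → (K :+ K) :+ (con 1ℚ :+ (X :+ X)) := (K :+ K) :+ (X :+ X) :+ con 1ℚ) refl K X))

odds : ℕ → List ℕ
odds P = applyUpTo (λ q → suc (2 ℕ.* q)) P

prodℚ-map-odds-suc : ∀ (f : ℕ → ℚ) P →
  prodℚ (map f (odds (suc P))) ≡ prodℚ (map f (odds P)) ℚ.* (f (suc (2 ℕ.* P)) ℚ.* 1ℚ)
prodℚ-map-odds-suc f P = begin
  prodℚ (map f (odds (suc P)))                        ≡⟨ cong (prodℚ ∘ map f) (LP.applyUpTo-∷ʳ (λ q → suc (2 ℕ.* q)) P) ⟨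
  prodℚ (map f (odds P ++ suc (2 ℕ.* P) ∷ []))        ≡⟨ cong prodℚ (LP.map-++ f (odds P) _) ⟩
  prodℚ (map f (odds P) ++ f (suc (2 ℕ.* P)) ∷ [])    ≡⟨ prodℚ-++ (map f (odds P)) _ ⟩
  prodℚ (map f (odds P)) ℚ.* (f (suc (2 ℕ.* P)) ℚ.* 1ℚ) ∎
  where open ≡-Reasoning

seqA-even-0*dfac-odds : ∀ k P →
  negpow (k ∸ P) ℚ.* seqA-even 0ℚ k ℚ.* prodℚ (map (dfac (2 ℕ.* k)) (odds P))
    ≡ negpow k ℚ.* seqA-even (fromℕ P) k
seqA-even-0*dfac-odds k zero = ℚP.*-identityʳ _  -- Uℚ.param (fromℕ 0) computes to 0ℚ
seqA-even-0*dfac-odds k (suc P) = begin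
  s₁ ℚ.* a₀ ℚ.* prodℚ (map (dfac (2 ℕ.* k)) (odds (suc P)))
    ≡⟨ cong (s₁ ℚ.* a₀ ℚ.*_) (prodℚ-map-odds-suc (dfac (2 ℕ.* k)) P) ⟩
  s₁ ℚ.* a₀ ℚ.* (Π ℚ.* (d ℚ.* 1ℚ))
    ≡⟨ ×-by-s₀² (s₁ ℚ.* a₀ ℚ.* (Π ℚ.* (d ℚ.* 1ℚ))) ⟩
  s₁ ℚ.* a₀ ℚ.* (Π ℚ.* (d ℚ.* 1ℚ)) ℚ.* (s₀ ℚ.* s₀)
    ≡⟨ solve 5 (λ s₁ a Π d s₀ → s₁ :* a :* (Π :* (d :* con 1ℚ)) :* (s₀ :* s₀) := s₀ :* a :* Π :* (s₁ :* d) :* s₀)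
             refl s₁ a₀ Π d s₀ ⟩
  s₀ ℚ.* a₀ ℚ.* Π ℚ.* (s₁ ℚ.* d) ℚ.* s₀
    ≡⟨ cong (λ x → x ℚ.* (s₁ ℚ.* d) ℚ.* s₀) (seqA-even-0*dfac-odds k P) ⟩
  negpow k ℚ.* Q₀ ℚ.* (s₁ ℚ.* d) ℚ.* s₀
    ≡⟨ solve 5 (λ n q s₁ d s₀ → n :* q :* (s₁ :* d) :* s₀ := n :* s₀ :* (s₁ :* d :* q)) refl (negpow k) Q₀ s₁ d s₀ ⟩
  negpow k ℚ.* s₀ ℚ.* (s₁ ℚ.* d ℚ.* Q₀)
    ≡⟨ cong (negpow k ℚ.* s₀ ℚ.*_) (dfac-seqA-even-step k P) ⟩
  negpow k ℚ.* s₀ ℚ.* (s₀ ℚ.* Q₁)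
    ≡⟨ solve 3 (λ n s₀ q → n :* s₀ :* (s₀ :* q) := n :* q :* (s₀ :* s₀)) refl (negpow k) s₀ Q₁ ⟩
  negpow k ℚ.* Q₁ ℚ.* (s₀ ℚ.* s₀)
    ≡⟨ ×-by-s₀² (negpow k ℚ.* Q₁) ⟨
  negpow k ℚ.* seqA-even (fromℕ (suc P)) k ∎
  where
  open ≡-Reasoning
  open ℚ-Solver
  s₀ = negpow (k ∸ P)
  s₁ = negpow (k ∸ suc P)
  a₀ = seqA-even 0ℚ k
  Π = prodℚ (map (dfac (2 ℕ.* k)) (odds P))
  d = dfac (2 ℕ.* k) (suc (2 ℕ.* P))
  Q₀ = seqA-even (fromℕ P) k
  Q₁ = seqA-even (fromℕ (suc P)) k
  ×-by-s₀² : ∀ x → x ≡ x ℚ.* (s₀ ℚ.* s₀)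
  ×-by-s₀² x = sym (trans (cong (x ℚ.*_) (negpow²≡1 (k ∸ P))) (ℚP.*-identityʳ x))

-- Parity bookkeeping on [n;m]

odd? : Decidable (λ i → i % 2 ≡ 1)
odd? i = i % 2 ℕ.≟ 1

even? : Decidable (λ i → i % 2 ≢ 1)
even? = ∁? odd?

2*n%2≢1 : ∀ n → 2 ℕ.* n % 2 ≢ 1
2*n%2≢1 n [2*n]%2≡1 = ℕP.0≢1+n (trans (sym (trans (cong (_% 2) (ℕP.*-comm 2 n)) (m*n%n≡0 n 2))) [2*n]%2≡1)

[1+2*n]%2≡1 : ∀ n → suc (2 ℕ.* n) % 2 ≡ 1
[1+2*n]%2≡1 n = trans (cong (λ k → suc k % 2) (ℕP.*-comm 2 n)) ([m+kn]%n≡m%n 1 n 2)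

data Parity : ℕ → Set where
  even : ∀ p → Parity (2 ℕ.* p)
  odd  : ∀ p → Parity (suc (2 ℕ.* p))

parity : ∀ n → Parity n
parity zero = even 0
parity (suc n) with parity n
... | even p = odd p
... | odd p = subst Parity (ℕP.*-suc 2 p) (even (suc p))

2*n/2≡n : ∀ n → 2 ℕ.* n / 2 ≡ n
2*n/2≡n n = trans (cong (_/ 2) (ℕP.*-comm 2 n)) (m*n/n≡m n 2)

ccoef-elem : ℕ → ℕ → ℕ
ccoef-elem n i = if n <ᵇ i then (i ∸ n) / 2 else 0

-- The guard is redundant: for i ≤ n the truncated difference i ∸ n is already 0.
ccoef-elem≡ : ∀ n i → ccoef-elem n i ≡ (i ∸ n) / 2
ccoef-elem≡ n i with n <ᵇ i in n<ᵇi
... | true = refl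
... | false = cong (_/ 2) (sym (ℕP.m≤n⇒m∸n≡0 (ℕP.≮⇒≥ (λ n<i → subst T n<ᵇi (ℕP.<⇒<ᵇ {n} {i} n<i)))))

evens : ℕ → List ℕ
evens M = applyUpTo (λ q → 2 ℕ.* suc q) M

applyUpTo-+ : ∀ {a} {A : Set a} (f : ℕ → A) m n →
  applyUpTo f (m ℕ.+ n) ≡ applyUpTo f m ++ applyUpTo (λ i → f (m ℕ.+ i)) n
applyUpTo-+ f zero n = refl
applyUpTo-+ f (suc m) n = cong (f 0 ∷_) (applyUpTo-+ (λ i → f (suc i)) m n)

module _ {a p} {A : Set a} {P : Pred A p} (P? : Decidable P) where

  filter-++-all : ∀ xs {ys} → All P ys → filter P? (xs ++ ys) ≡ filter P? xs ++ ys
  filter-++-all xs Pys = trans (LP.filter-++ P? xs _) (cong (filter P? xs ++_) (LP.filter-all P? Pys))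

  filter-++-none : ∀ xs {ys} → All (∁ P) ys → filter P? (xs ++ ys) ≡ filter P? xs
  filter-++-none xs ¬Pys =
    trans (LP.filter-++ P? xs _) (trans (cong (filter P? xs ++_) (LP.filter-none P? ¬Pys)) (LP.++-identityʳ _))

1⋯2[p+1] : ∀ p →
  applyUpTo suc (2 ℕ.* suc p) ≡ (applyUpTo suc (2 ℕ.* p) ++ suc (2 ℕ.* p) ∷ []) ++ 2 ℕ.* suc p ∷ []
1⋯2[p+1] p = begin
  applyUpTo suc (2 ℕ.* suc p)                                            ≡⟨ cong (applyUpTo suc) (ℕP.*-suc 2 p) ⟩
  applyUpTo suc (suc (suc (2 ℕ.* p)))                                    ≡⟨ LP.applyUpTo-∷ʳ suc (suc (2 ℕ.* p)) ⟨
  applyUpTo suc (suc (2 ℕ.* p)) ++ suc (suc (2 ℕ.* p)) ∷ []             ≡⟨ cong₂ (λ xs x → xs ++ x ∷ [])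
                                                                               (LP.applyUpTo-∷ʳ suc (2 ℕ.* p)) (ℕP.*-suc 2 p) ⟨
  (applyUpTo suc (2 ℕ.* p) ++ suc (2 ℕ.* p) ∷ []) ++ 2 ℕ.* suc p ∷ []   ∎
  where open ≡-Reasoning

filter-odd?-1⋯2p : ∀ p → filter odd? (applyUpTo suc (2 ℕ.* p)) ≡ odds p
filter-odd?-1⋯2p zero = refl
filter-odd?-1⋯2p (suc p) = begin
  filter odd? (applyUpTo suc (2 ℕ.* suc p))
    ≡⟨ cong (filter odd?) (1⋯2[p+1] p) ⟩
  filter odd? ((1⋯2p ++ suc (2 ℕ.* p) ∷ []) ++ 2 ℕ.* suc p ∷ [])
    ≡⟨ filter-++-none odd? (1⋯2p ++ suc (2 ℕ.* p) ∷ []) (2*n%2≢1 (suc p) ∷ []) ⟩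
  filter odd? (1⋯2p ++ suc (2 ℕ.* p) ∷ [])
    ≡⟨ filter-++-all odd? 1⋯2p ([1+2*n]%2≡1 p ∷ []) ⟩
  filter odd? 1⋯2p ++ suc (2 ℕ.* p) ∷ []
    ≡⟨ cong (_++ suc (2 ℕ.* p) ∷ []) (filter-odd?-1⋯2p p) ⟩
  odds p ++ suc (2 ℕ.* p) ∷ []
    ≡⟨ LP.applyUpTo-∷ʳ (λ q → suc (2 ℕ.* q)) p ⟩
  odds (suc p) ∎
  where
  open ≡-Reasoning
  1⋯2p = applyUpTo suc (2 ℕ.* p)

filter-even?-1⋯2p : ∀ p → filter even? (applyUpTo suc (2 ℕ.* p)) ≡ evens p
filter-even?-1⋯2p zero = refl
filter-even?-1⋯2p (suc p) = begin
  filter even? (applyUpTo suc (2 ℕ.* suc p))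
    ≡⟨ cong (filter even?) (1⋯2[p+1] p) ⟩
  filter even? ((1⋯2p ++ suc (2 ℕ.* p) ∷ []) ++ 2 ℕ.* suc p ∷ [])
    ≡⟨ filter-++-all even? (1⋯2p ++ suc (2 ℕ.* p) ∷ []) (2*n%2≢1 (suc p) ∷ []) ⟩
  filter even? (1⋯2p ++ suc (2 ℕ.* p) ∷ []) ++ 2 ℕ.* suc p ∷ []
    ≡⟨ cong (_++ 2 ℕ.* suc p ∷ []) (filter-++-none even? 1⋯2p (¬even ∷ [])) ⟩
  filter even? 1⋯2p ++ 2 ℕ.* suc p ∷ []
    ≡⟨ cong (_++ 2 ℕ.* suc p ∷ []) (filter-even?-1⋯2p p) ⟩
  evens p ++ 2 ℕ.* suc p ∷ []
    ≡⟨ LP.applyUpTo-∷ʳ (λ q → 2 ℕ.* suc q) p ⟩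
  evens (suc p) ∎
  where
  open ≡-Reasoning
  1⋯2p = applyUpTo suc (2 ℕ.* p)
  ¬even : ¬ suc (2 ℕ.* p) % 2 ≢ 1
  ¬even ¬odd = ¬odd ([1+2*n]%2≡1 p)

nm-set-2* : ∀ p m → nm-set (2 ℕ.* p) m ≡ applyUpTo suc (2 ℕ.* p) ++ applyUpTo (λ k → 2 ℕ.* suc (p ℕ.+ k)) m
nm-set-2* p m = cong₂ _++_ (LP.map-upTo suc (2 ℕ.* p))
                           (trans (LP.map-cong (shift p) (upTo m)) (LP.map-upTo (λ k → 2 ℕ.* suc (p ℕ.+ k)) m))
  where
  shift : ∀ p k → 2 ℕ.* p ℕ.+ 2 ℕ.* suc k ≡ 2 ℕ.* suc (p ℕ.+ k)
  shift = solve-∀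

nm-set-1+2* : ∀ p m →
  nm-set (suc (2 ℕ.* p)) m ≡ applyUpTo suc (2 ℕ.* p) ++ applyUpTo (λ k → suc (2 ℕ.* (p ℕ.+ k))) (suc m)
nm-set-1+2* p m = begin
  map suc (upTo (suc (2 ℕ.* p))) ++ map (λ k → suc (2 ℕ.* p) ℕ.+ 2 ℕ.* suc k) (upTo m)
    ≡⟨ cong₂ _++_ (trans (LP.map-upTo suc (suc (2 ℕ.* p))) (sym (LP.applyUpTo-∷ʳ suc (2 ℕ.* p))))
                  (trans (LP.map-cong (shift p) (upTo m)) (LP.map-upTo (λ k → suc (2 ℕ.* (p ℕ.+ suc k))) m)) ⟩
  (applyUpTo suc (2 ℕ.* p) ++ suc (2 ℕ.* p) ∷ []) ++ applyUpTo (λ k → suc (2 ℕ.* (p ℕ.+ suc k))) m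
    ≡⟨ LP.++-assoc (applyUpTo suc (2 ℕ.* p)) _ _ ⟩
  applyUpTo suc (2 ℕ.* p) ++ suc (2 ℕ.* p) ∷ applyUpTo (λ k → suc (2 ℕ.* (p ℕ.+ suc k))) m
    ≡⟨ cong (λ q → applyUpTo suc (2 ℕ.* p) ++ suc (2 ℕ.* q) ∷ applyUpTo (λ k → suc (2 ℕ.* (p ℕ.+ suc k))) m)
            (ℕP.+-identityʳ p) ⟨
  applyUpTo suc (2 ℕ.* p) ++ applyUpTo (λ k → suc (2 ℕ.* (p ℕ.+ k))) (suc m) ∎
  where
  open ≡-Reasoning
  shift : ∀ p k → suc (2 ℕ.* p) ℕ.+ 2 ℕ.* suc k ≡ suc (2 ℕ.* (p ℕ.+ suc k))
  shift = solve-∀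

module _ (p m : ℕ) where

  private
    1⋯2p evens-beyond odds-beyond : List ℕ
    1⋯2p = applyUpTo suc (2 ℕ.* p)
    evens-beyond = applyUpTo (λ k → 2 ℕ.* suc (p ℕ.+ k)) m
    odds-beyond = applyUpTo (λ k → suc (2 ℕ.* (p ℕ.+ k))) (suc m)

    evens-beyond-even : All (λ i → i % 2 ≢ 1) evens-beyond
    evens-beyond-even = applyUpTo⁺₂ (λ k → 2 ℕ.* suc (p ℕ.+ k)) m (λ k → 2*n%2≢1 (suc (p ℕ.+ k)))

    odds-beyond-odd : All (λ i → i % 2 ≡ 1) odds-beyond
    odds-beyond-odd = applyUpTo⁺₂ (λ k → suc (2 ℕ.* (p ℕ.+ k))) (suc m) (λ k → [1+2*n]%2≡1 (p ℕ.+ k))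

  filter-odd?-nm-set-2* : filter odd? (nm-set (2 ℕ.* p) m) ≡ odds p
  filter-odd?-nm-set-2* = begin
    filter odd? (nm-set (2 ℕ.* p) m)      ≡⟨ cong (filter odd?) (nm-set-2* p m) ⟩
    filter odd? (1⋯2p ++ evens-beyond)    ≡⟨ filter-++-none odd? 1⋯2p evens-beyond-even ⟩
    filter odd? 1⋯2p                      ≡⟨ filter-odd?-1⋯2p p ⟩
    odds p                                ∎
    where open ≡-Reasoning

  filter-even?-nm-set-2* : filter even? (nm-set (2 ℕ.* p) m) ≡ evens (p ℕ.+ m)
  filter-even?-nm-set-2* = begin
    filter even? (nm-set (2 ℕ.* p) m)          ≡⟨ cong (filter even?) (nm-set-2* p m) ⟩
    filter even? (1⋯2p ++ evens-beyond)        ≡⟨ filter-++-all even? 1⋯2p evens-beyond-even ⟩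
    filter even? 1⋯2p ++ evens-beyond          ≡⟨ cong (_++ evens-beyond) (filter-even?-1⋯2p p) ⟩
    evens p ++ evens-beyond                    ≡⟨ applyUpTo-+ (λ q → 2 ℕ.* suc q) p m ⟨
    evens (p ℕ.+ m)                            ∎
    where open ≡-Reasoning

  filter-odd?-nm-set-1+2* : filter odd? (nm-set (suc (2 ℕ.* p)) m) ≡ odds (p ℕ.+ suc m)
  filter-odd?-nm-set-1+2* = begin
    filter odd? (nm-set (suc (2 ℕ.* p)) m)     ≡⟨ cong (filter odd?) (nm-set-1+2* p m) ⟩
    filter odd? (1⋯2p ++ odds-beyond)          ≡⟨ filter-++-all odd? 1⋯2p odds-beyond-odd ⟩
    filter odd? 1⋯2p ++ odds-beyond            ≡⟨ cong (_++ odds-beyond) (filter-odd?-1⋯2p p) ⟩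
    odds p ++ odds-beyond                      ≡⟨ applyUpTo-+ (λ q → suc (2 ℕ.* q)) p (suc m) ⟨
    odds (p ℕ.+ suc m)                         ∎
    where open ≡-Reasoning

  filter-even?-nm-set-1+2* : filter even? (nm-set (suc (2 ℕ.* p)) m) ≡ evens p
  filter-even?-nm-set-1+2* = begin
    filter even? (nm-set (suc (2 ℕ.* p)) m)    ≡⟨ cong (filter even?) (nm-set-1+2* p m) ⟩
    filter even? (1⋯2p ++ odds-beyond)         ≡⟨ filter-++-none even? 1⋯2p (All.map (λ i-odd ¬odd → ¬odd i-odd) odds-beyond-odd) ⟩
    filter even? 1⋯2p                          ≡⟨ filter-even?-1⋯2p p ⟩
    evens p                                    ∎
    where open ≡-Reasoning

size-odds : ∀ P → size (odds P) ≡ P ℕ.^ 2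
size-odds zero = refl
size-odds (suc P) = begin
  size (odds (suc P))                            ≡⟨ cong size (LP.applyUpTo-∷ʳ (λ q → suc (2 ℕ.* q)) P) ⟨
  size (odds P ++ suc (2 ℕ.* P) ∷ [])            ≡⟨ sum-++ (odds P) (suc (2 ℕ.* P) ∷ []) ⟩
  size (odds P) ℕ.+ (suc (2 ℕ.* P) ℕ.+ 0)        ≡⟨ cong (ℕ._+ (suc (2 ℕ.* P) ℕ.+ 0)) (size-odds P) ⟩
  P ℕ.^ 2 ℕ.+ (suc (2 ℕ.* P) ℕ.+ 0)              ≡⟨ square-suc P ⟩
  suc P ℕ.^ 2                                    ∎
  where
  open ≡-Reasoning
  -- x ^ 2 unfolded to x * (x * 1), the form the ℕ ring solver accepts
  square-suc : ∀ P → P ℕ.* (P ℕ.* 1) ℕ.+ (suc (2 ℕ.* P) ℕ.+ 0) ≡ suc P ℕ.* (suc P ℕ.* 1)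
  square-suc = solve-∀

-- Umemura polynomials over a ℚ-algebra

module _ {c ℓ} (R : CommutativeRing c ℓ) (ι : ℚ → CommutativeRing.Carrier R) (ι-hom : IsℚAlgebraMap R ι) where

  open CommutativeRing R renaming (refl to ≈-refl; sym to ≈-sym; trans to ≈-trans)
  open Umemura R ι
  open RingMorphisms.IsRingHomomorphism ι-hom
  open import Relation.Binary.Reasoning.Setoid setoid
  open import Algebra.Properties.Ring ring using (-0#≈0#)
  open import Algebra.Solver.Ring.NaturalCoefficients.Default commutativeSemiring

  prod-map-* : ∀ (f g : ℕ → Carrier) L → prod (map (λ x → f x * g x) L) ≈ prod (map f L) * prod (map g L)
  prod-map-* f g [] = ≈-sym (*-identityˡ 1#)
  prod-map-* f g (x ∷ L) = begin
    f x * g x * prod (map (λ x → f x * g x) L)         ≈⟨ *-congˡ (prod-map-* f g L) ⟩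
    f x * g x * (prod (map f L) * prod (map g L))      ≈⟨ solve 4 (λ a b c d → a :* b :* (c :* d) := a :* c :* (b :* d)) ≈-refl (f x) (g x) _ _ ⟩
    f x * prod (map f L) * (g x * prod (map g L))      ∎

  sum-map-cong : ∀ {A : Set} {f g : A → Carrier} → (∀ x → f x ≈ g x) → ∀ xs → sum (map f xs) ≈ sum (map g xs)
  sum-map-cong f≈g [] = ≈-refl
  sum-map-cong f≈g (x ∷ xs) = +-cong (f≈g x) (sum-map-cong f≈g xs)

  pow-+ : ∀ x a b → pow x (a ℕ.+ b) ≈ pow x a * pow x b
  pow-+ x zero b = ≈-sym (*-identityˡ _)
  pow-+ x (suc a) b = ≈-trans (*-congˡ (pow-+ x a b)) (≈-sym (*-assoc x (pow x a) (pow x b)))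

  pow-size : ∀ x I → pow x (size I) ≈ prod (map (pow x) I)
  pow-size x [] = ≈-refl
  pow-size x (i ∷ I) = ≈-trans (pow-+ x i (size I)) (*-congˡ (pow-size x I))

  module Splitting (G : ℕ → ℕ → Carrier) where

    splitTerm : (ℕ → Carrier) → (ℕ → Carrier) → List ℕ × List ℕ → Carrier
    splitTerm A B (I , J) = prod (map A I) * prod (map B J) * prod (map (λ i → prod (map (G i) J)) I)

    splitSum : (ℕ → Carrier) → (ℕ → Carrier) → List ℕ → Carrier
    splitSum A B L = sum (map (splitTerm A B) (splits L))

    splitTerm-∷ˡ : ∀ A B y I J → splitTerm A B (y ∷ I , J) ≈ A y * splitTerm A (λ j → B j * G y j) (I , J)
    splitTerm-∷ˡ A B y I J = begin
      A y * prod (map A I) * prod (map B J) * (prod (map (G y) J) * prod (map (λ i → prod (map (G i) J)) I))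
        ≈⟨ solve 5 (λ a pa pb g pg → a :* pa :* pb :* (g :* pg) := a :* (pa :* (pb :* g) :* pg)) ≈-refl (A y) _ _ _ _ ⟩
      A y * (prod (map A I) * (prod (map B J) * prod (map (G y) J)) * prod (map (λ i → prod (map (G i) J)) I))
        ≈⟨ *-congˡ (*-congʳ (*-congˡ (prod-map-* B (G y) J))) ⟨
      A y * splitTerm A (λ j → B j * G y j) (I , J) ∎

    splitTerm-∷ʳ : ∀ A B y I J → splitTerm A B (I , y ∷ J) ≈ B y * splitTerm (λ i → A i * G i y) B (I , J)
    splitTerm-∷ʳ A B y I J = begin
      prod (map A I) * (B y * prod (map B J)) * prod (map (λ i → G i y * prod (map (G i) J)) I)
        ≈⟨ *-congˡ (prod-map-* (λ i → G i y) (λ i → prod (map (G i) J)) I) ⟩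
      prod (map A I) * (B y * prod (map B J)) * (prod (map (λ i → G i y) I) * prod (map (λ i → prod (map (G i) J)) I))
        ≈⟨ solve 5 (λ pa b pb g pg → pa :* (b :* pb) :* (g :* pg) := b :* ((pa :* g) :* pb :* pg)) ≈-refl _ (B y) _ _ _ ⟩
      B y * ((prod (map A I) * prod (map (λ i → G i y) I)) * prod (map B J) * prod (map (λ i → prod (map (G i) J)) I))
        ≈⟨ *-congˡ (*-congʳ (*-congʳ (prod-map-* A (λ i → G i y) I))) ⟨
      B y * splitTerm (λ i → A i * G i y) B (I , J) ∎

    splitSum-∷ : ∀ A B y L →
      splitSum A B (y ∷ L) ≈ A y * splitSum A (λ j → B j * G y j) L + B y * splitSum (λ i → A i * G i y) B L
    splitSum-∷ A B y L = sum-extend (splits L)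
      where
      Aᵧ = λ i → A i * G i y
      Bᵧ = λ j → B j * G y j
      extend : List ℕ × List ℕ → List (List ℕ × List ℕ)
      extend (I , J) = (y ∷ I , J) ∷ (I , y ∷ J) ∷ []
      sum-extend : ∀ S →
        sum (map (splitTerm A B) (concatMap extend S))
          ≈ A y * sum (map (splitTerm A Bᵧ) S) + B y * sum (map (splitTerm Aᵧ B) S)
      sum-extend [] = ≈-sym (≈-trans (+-cong (zeroʳ (A y)) (zeroʳ (B y))) (+-identityʳ 0#))
      sum-extend ((I , J) ∷ S) = begin
        splitTerm A B (y ∷ I , J) + (splitTerm A B (I , y ∷ J) + sum (map (splitTerm A B) (concatMap extend S)))
          ≈⟨ +-cong (splitTerm-∷ˡ A B y I J) (+-cong (splitTerm-∷ʳ A B y I J) (sum-extend S)) ⟩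
        A y * t₁ + (B y * t₂ + (A y * s₁ + B y * s₂))
          ≈⟨ solve 6 (λ a b t₁ t₂ s₁ s₂ → a :* t₁ :+ (b :* t₂ :+ (a :* s₁ :+ b :* s₂)) := a :* (t₁ :+ s₁) :+ b :* (t₂ :+ s₂))
                   ≈-refl (A y) (B y) t₁ t₂ s₁ s₂ ⟩
        A y * (t₁ + s₁) + B y * (t₂ + s₂) ∎
        where
        t₁ = splitTerm A Bᵧ (I , J)
        t₂ = splitTerm Aᵧ B (I , J)
        s₁ = sum (map (splitTerm A Bᵧ) S)
        s₂ = sum (map (splitTerm Aᵧ B) S)

    splitSum-cong : ∀ {A A′ B B′} L → All (λ i → A i ≈ A′ i) L → (∀ j → B j ≈ B′ j) → splitSum A B L ≈ splitSum A′ B′ L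
    splitSum-cong [] [] _ = ≈-refl
    splitSum-cong {A} {A′} {B} {B′} (y ∷ L) (Ay≈A′y ∷ A≈A′) B≈B′ = begin
      splitSum A B (y ∷ L)
        ≈⟨ splitSum-∷ A B y L ⟩
      A y * splitSum A (λ j → B j * G y j) L + B y * splitSum (λ i → A i * G i y) B L
        ≈⟨ +-cong (*-cong Ay≈A′y (splitSum-cong L A≈A′ (λ j → *-congʳ (B≈B′ j))))
                  (*-cong (B≈B′ y) (splitSum-cong L (All.map *-congʳ A≈A′) B≈B′)) ⟩
      A′ y * splitSum A′ (λ j → B′ j * G y j) L + B′ y * splitSum (λ i → A′ i * G i y) B′ L
        ≈⟨ splitSum-∷ A′ B′ y L ⟨
      splitSum A′ B′ (y ∷ L) ∎

    splitSum-filter : ∀ {P : Pred ℕ 0ℓ} (P? : Decidable P) A B L → (∀ i → P i → A i ≈ 0#) →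
      splitSum A B L
        ≈ prod (map B (filter P? L)) * splitSum (λ i → A i * prod (map (G i) (filter P? L))) B (filter (∁? P?) L)
    splitSum-filter P? A B [] _ = ≈-sym (*-identityˡ _)
    splitSum-filter P? A B (y ∷ L) A≈0 with P? y
    ... | yes Py = begin
      splitSum A B (y ∷ L)
        ≈⟨ splitSum-∷ A B y L ⟩
      A y * splitSum A (λ j → B j * G y j) L + B y * splitSum Aᵧ B L
        ≈⟨ +-congʳ (≈-trans (*-congʳ (A≈0 y Py)) (zeroˡ _)) ⟩
      0# + B y * splitSum Aᵧ B L
        ≈⟨ +-identityˡ _ ⟩
      B y * splitSum Aᵧ B L
        ≈⟨ *-congˡ (splitSum-filter P? Aᵧ B L (λ i Pi → ≈-trans (*-congʳ (A≈0 i Pi)) (zeroˡ _))) ⟩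
      B y * (prod (map B O) * splitSum (λ i → Aᵧ i * prod (map (G i) O)) B E)
        ≈⟨ *-assoc (B y) _ _ ⟨
      B y * prod (map B O) * splitSum (λ i → Aᵧ i * prod (map (G i) O)) B E
        ≈⟨ *-congˡ (splitSum-cong E (All.tabulate λ {i} _ → *-assoc (A i) (G i y) _) (λ _ → ≈-refl)) ⟩
      B y * prod (map B O) * splitSum (λ i → A i * (G i y * prod (map (G i) O))) B E ∎
      where
      Aᵧ = λ i → A i * G i y
      O = filter P? L
      E = filter (∁? P?) L
    ... | no ¬Py = begin
      splitSum A B (y ∷ L)
        ≈⟨ splitSum-∷ A B y L ⟩
      A y * splitSum A Bᵧ L + B y * splitSum Aᵧ B L
        ≈⟨ +-cong (*-congˡ (splitSum-filter P? A Bᵧ L A≈0))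
                  (*-congˡ (splitSum-filter P? Aᵧ B L (λ i Pi → ≈-trans (*-congʳ (A≈0 i Pi)) (zeroˡ _)))) ⟩
      A y * (prod (map Bᵧ O) * splitSum A₀ Bᵧ E) + B y * (prod (map B O) * splitSum (λ i → Aᵧ i * prod (map (G i) O)) B E)
        ≈⟨ +-cong (*-congˡ (*-congʳ (prod-map-* B (G y) O)))
                  (*-congˡ (*-congˡ (splitSum-cong E (All.tabulate λ {i} _ → reorder (A i) (G i y) _) (λ _ → ≈-refl)))) ⟩
      A y * (prod (map B O) * prod (map (G y) O) * splitSum A₀ Bᵧ E) + B y * (prod (map B O) * splitSum (λ i → A₀ i * G i y) B E)
        ≈⟨ solve 6 (λ a b pb pg s₁ s₂ → a :* (pb :* pg :* s₁) :+ b :* (pb :* s₂) := pb :* (a :* pg :* s₁ :+ b :* s₂))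
                 ≈-refl (A y) (B y) (prod (map B O)) (prod (map (G y) O)) _ _ ⟩
      prod (map B O) * (A₀ y * splitSum A₀ Bᵧ E + B y * splitSum (λ i → A₀ i * G i y) B E)
        ≈⟨ *-congˡ (splitSum-∷ A₀ B y E) ⟨
      prod (map B O) * splitSum A₀ B (y ∷ E) ∎
      where
      Aᵧ = λ i → A i * G i y
      Bᵧ = λ j → B j * G y j
      O = filter P? L
      E = filter (∁? P?) L
      A₀ = λ i → A i * prod (map (G i) O)
      reorder : ∀ a g p → a * g * p ≈ a * p * g
      reorder = solve 3 (λ a g p → a :* g :* p := a :* p :* g) ≈-refl

  δ : ℕ → ℕ → Carrier
  δ i j = ι (dfac i j)

  open Splitting δ

  zWeight : ℕ → Carrier → Carrier → ℕ → Carrier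
  zWeight n a z i = ι (negpow (ccoef-elem n i)) * seqA a i * pow z i

  wWeight : Carrier → Carrier → ℕ → Carrier
  wWeight b w j = seqA b j * pow w j

  ι-prodℚ-map : ∀ (f : ℕ → ℚ) L → ι (prodℚ (map f L)) ≈ prod (map (λ x → ι (f x)) L)
  ι-prodℚ-map f [] = 1#-homo
  ι-prodℚ-map f (x ∷ L) = ≈-trans (*-homo (f x) _) (*-congˡ (ι-prodℚ-map f L))

  ι-dcoef : ∀ I J → ι (dcoef I J) ≈ prod (map (λ i → prod (map (δ i) J)) I)
  ι-dcoef [] J = 1#-homo
  ι-dcoef (i ∷ I) J = begin
    ι (prodℚ (map (dfac i) J ++ concatMap (λ i → map (dfac i) J) I))   ≡⟨ cong ι (prodℚ-++ (map (dfac i) J) _) ⟩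
    ι (prodℚ (map (dfac i) J) ℚ.* dcoef I J)                           ≈⟨ *-homo _ _ ⟩
    ι (prodℚ (map (dfac i) J)) * ι (dcoef I J)                         ≈⟨ *-cong (ι-prodℚ-map (dfac i) J) (ι-dcoef I J) ⟩
    prod (map (δ i) J) * prod (map (λ i → prod (map (δ i) J)) I)       ∎

  ι-negpow-ccoef : ∀ n I → ι (negpow (ccoef n I)) ≈ prod (map (λ i → ι (negpow (ccoef-elem n i))) I)
  ι-negpow-ccoef n [] = 1#-homo
  ι-negpow-ccoef n (i ∷ I) = begin
    ι (negpow (ccoef-elem n i ℕ.+ ccoef n I))                ≡⟨ cong ι (negpow-+ (ccoef-elem n i) (ccoef n I)) ⟩
    ι (negpow (ccoef-elem n i) ℚ.* negpow (ccoef n I))       ≈⟨ *-homo _ _ ⟩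
    ι (negpow (ccoef-elem n i)) * ι (negpow (ccoef n I))     ≈⟨ *-congˡ (ι-negpow-ccoef n I) ⟩
    prod (map (λ i → ι (negpow (ccoef-elem n i))) (i ∷ I))   ∎

  term≈splitTerm : ∀ n a b z w I J →
    ι (dcoef I J ℚ.* negpow (ccoef n I)) * seqA-set a I * seqA-set b J * pow z (size I) * pow w (size J)
      ≈ splitTerm (zWeight n a z) (wWeight b w) (I , J)
  term≈splitTerm n a b z w I J = begin
    ι (dcoef I J ℚ.* negpow (ccoef n I)) * seqA-set a I * seqA-set b J * pow z (size I) * pow w (size J)
      ≈⟨ *-cong (*-cong (*-congʳ (*-congʳ (≈-trans (*-homo _ _) (*-cong (ι-dcoef I J) (ι-negpow-ccoef n I)))))
                        (pow-size z I))
                (pow-size w J) ⟩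
    d * s * sa * sb * pz * pw
      ≈⟨ solve 6 (λ d s sa sb pz pw → d :* s :* sa :* sb :* pz :* pw := s :* sa :* pz :* (sb :* pw) :* d)
               ≈-refl d s sa sb pz pw ⟩
    s * sa * pz * (sb * pw) * d
      ≈⟨ *-congʳ (*-cong (≈-trans (*-congʳ (≈-sym (prod-map-* _ _ I))) (≈-sym (prod-map-* _ _ I)))
                         (≈-sym (prod-map-* _ _ J))) ⟩
    splitTerm (zWeight n a z) (wWeight b w) (I , J) ∎
    where
    d = prod (map (λ i → prod (map (δ i) J)) I)
    s = prod (map (λ i → ι (negpow (ccoef-elem n i))) I)
    sa = seqA-set a I
    sb = seqA-set b J
    pz = prod (map (pow z) I)
    pw = prod (map (pow w) J)

  U-splitSum : ∀ n m z w a b → U n m z w a b ≈ splitSum (zWeight n a z) (wWeight b w) (nm-set n m)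
  U-splitSum n m z w a b = sum-map-cong (λ (I , J) → term≈splitTerm n a b z w I J) (splits (nm-set n m))

  param-0# : param 0# ≈ 0#
  param-0# = ≈-trans (-‿cong (zeroʳ _)) -0#≈0#

  -- (2 + i) % 2 reduces to i % 2, so the parity proof is passed down unchanged.
  seqA-odd≈0 : ∀ {a} → a ≈ 0# → ∀ i → i % 2 ≡ 1 → seqA a i ≈ 0#
  seqA-odd≈0 a≈0 (suc zero) _ = ≈-trans (+-cong a≈0 0#-homo) (+-identityʳ 0#)
  seqA-odd≈0 a≈0 (suc (suc i)) i-odd = ≈-trans (*-congˡ (seqA-odd≈0 a≈0 i i-odd)) (zeroʳ _)

  ι-param : ∀ {β q} → β ≈ ι q → param β ≈ ι (Uℚ.param q)
  ι-param {β} {q} β≈ιq = begin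
    - (nat 4 * β * β)               ≈⟨ -‿cong (*-cong (*-congˡ β≈ιq) β≈ιq) ⟩
    - (ι (fromℕ 4) * ι q * ι q)     ≈⟨ -‿cong (*-congʳ (*-homo (fromℕ 4) q)) ⟨
    - (ι (fromℕ 4 ℚ.* q) * ι q)     ≈⟨ -‿cong (*-homo (fromℕ 4 ℚ.* q) q) ⟨
    - ι (fromℕ 4 ℚ.* q ℚ.* q)       ≈⟨ -‿homo _ ⟨
    ι (Uℚ.param q)                  ∎

  ι-seqA : ∀ {a q} → a ≈ ι q → ∀ i → seqA a i ≈ ι (Uℚ.seqA q i)
  ι-seqA a≈ιq zero = ≈-sym 1#-homo
  ι-seqA a≈ιq (suc zero) = ≈-trans (+-congʳ a≈ιq) (≈-sym (+-homo _ _))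
  ι-seqA a≈ιq (suc (suc i)) =
    ≈-trans (*-cong (≈-trans (+-congʳ a≈ιq) (≈-sym (+-homo _ _))) (ι-seqA a≈ιq i)) (≈-sym (*-homo _ _))

  zWeight-absorbs-odds : ∀ n P z k → (2 ℕ.* k ∸ n) / 2 ≡ k ∸ P →
    zWeight n (param 0#) z (2 ℕ.* k) * prod (map (δ (2 ℕ.* k)) (odds P)) ≈ zWeight 0 (param (ι (fromℕ P))) z (2 ℕ.* k)
  zWeight-absorbs-odds n P z k sign = begin
    ι (negpow (ccoef-elem n (2 ℕ.* k))) * seqA (param 0#) (2 ℕ.* k) * pow z (2 ℕ.* k) * prod (map (δ (2 ℕ.* k)) (odds P))
      ≈⟨ *-cong (*-congʳ (*-cong (reflexive (cong (ι ∘ negpow) (trans (ccoef-elem≡ n (2 ℕ.* k)) sign)))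
                                 (ι-seqA (ι-param (≈-sym 0#-homo)) (2 ℕ.* k))))
                (≈-sym (ι-prodℚ-map (dfac (2 ℕ.* k)) (odds P))) ⟩
    ι s * ι a₀ * pow z (2 ℕ.* k) * ι Π
      ≈⟨ solve 4 (λ s a p Π → s :* a :* p :* Π := s :* a :* Π :* p) ≈-refl (ι s) (ι a₀) (pow z (2 ℕ.* k)) (ι Π) ⟩
    ι s * ι a₀ * ι Π * pow z (2 ℕ.* k)
      ≈⟨ *-congʳ (≈-trans (*-homo (s ℚ.* a₀) Π) (*-congʳ (*-homo s a₀))) ⟨
    ι (s ℚ.* a₀ ℚ.* Π) * pow z (2 ℕ.* k)
      ≡⟨ cong (λ x → ι x * pow z (2 ℕ.* k)) (seqA-even-0*dfac-odds k P) ⟩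
    ι (negpow k ℚ.* seqA-even (fromℕ P) k) * pow z (2 ℕ.* k)
      ≈⟨ *-congʳ (*-homo (negpow k) (seqA-even (fromℕ P) k)) ⟩
    ι (negpow k) * ι (seqA-even (fromℕ P) k) * pow z (2 ℕ.* k)
      ≈⟨ *-congʳ (*-cong (reflexive (cong (ι ∘ negpow) (trans (ccoef-elem≡ 0 (2 ℕ.* k)) (2*n/2≡n k))))
                         (ι-seqA (ι-param ≈-refl) (2 ℕ.* k))) ⟨
    zWeight 0 (param (ι (fromℕ P))) z (2 ℕ.* k) ∎
    where
    s = negpow (k ∸ P)
    a₀ = seqA-even 0ℚ k
    Π = prodℚ (map (dfac (2 ℕ.* k)) (odds P))

  U-at-param-0 : ∀ n m P M b z w →
    filter odd? (nm-set n m) ≡ odds P →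
    filter even? (nm-set n m) ≡ evens M →
    (∀ {k} → k < M → (2 ℕ.* suc k ∸ n) / 2 ≡ suc k ∸ P) →
    U n m z w (param 0#) b ≈ seqA-set b (odd-part n m) * pow w (P ℕ.^ 2) * U 0 M z w (param (ι (fromℕ P))) b
  U-at-param-0 n m P M b z w odds≡ evens≡ sign = begin
    U n m z w (param 0#) b
      ≈⟨ U-splitSum n m z w (param 0#) b ⟩
    splitSum A B (nm-set n m)
      ≈⟨ splitSum-filter odd? A B (nm-set n m) A-odd≈0 ⟩
    prod (map B O) * splitSum Aₒ B E
      ≈⟨ *-cong (≈-trans (prod-map-* (seqA b) (pow w) O) (*-congˡ (≈-sym (pow-size w O)))) Aₒ-part ⟩
    seqA-set b O * pow w (size O) * U 0 M z w (param (ι (fromℕ P))) b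
      ≡⟨ cong (λ O → seqA-set b (odd-part n m) * pow w (size O) * U 0 M z w (param (ι (fromℕ P))) b) odds≡ ⟩
    seqA-set b (odd-part n m) * pow w (size (odds P)) * U 0 M z w (param (ι (fromℕ P))) b
      ≡⟨ cong (λ e → seqA-set b (odd-part n m) * pow w e * U 0 M z w (param (ι (fromℕ P))) b) (size-odds P) ⟩
    seqA-set b (odd-part n m) * pow w (P ℕ.^ 2) * U 0 M z w (param (ι (fromℕ P))) b ∎
    where
    A = zWeight n (param 0#) z
    B = wWeight b w
    O = filter odd? (nm-set n m)
    E = filter even? (nm-set n m)
    Aₒ = λ i → A i * prod (map (δ i) O)
    A-odd≈0 : ∀ i → i % 2 ≡ 1 → A i ≈ 0#
    A-odd≈0 i i-odd = ≈-trans (*-congʳ (≈-trans (*-congˡ (seqA-odd≈0 param-0# i i-odd)) (zeroʳ _))) (zeroˡ _)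
    Aₒ≈ : ∀ k → (2 ℕ.* suc k ∸ n) / 2 ≡ suc k ∸ P → Aₒ (2 ℕ.* suc k) ≈ zWeight 0 (param (ι (fromℕ P))) z (2 ℕ.* suc k)
    Aₒ≈ k sign-k = ≈-trans (*-congˡ (reflexive (cong (prod ∘ map (δ (2 ℕ.* suc k))) odds≡)))
                           (zWeight-absorbs-odds n P z (suc k) sign-k)
    Aₒ-part : splitSum Aₒ B E ≈ U 0 M z w (param (ι (fromℕ P))) b
    Aₒ-part = begin
      splitSum Aₒ B E
        ≡⟨ cong (splitSum Aₒ B) (trans evens≡ (sym (LP.map-upTo (λ k → 2 ℕ.* suc k) M))) ⟩
      splitSum Aₒ B (nm-set 0 M)
        ≈⟨ splitSum-cong (nm-set 0 M) (map⁺ (applyUpTo⁺₁ id M λ {k} k<M → Aₒ≈ k (sign k<M))) (λ _ → ≈-refl) ⟩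
      splitSum (zWeight 0 (param (ι (fromℕ P))) z) B (nm-set 0 M)
        ≈⟨ U-splitSum 0 M z w (param (ι (fromℕ P))) b ⟨
      U 0 M z w (param (ι (fromℕ P))) b ∎

  Uβ-at-even : ∀ p m b₂ z w →
    Uβ (2 ℕ.* p) m z w 0# b₂
      ≈ seqA-set (param b₂) (odd-part (2 ℕ.* p) m) * pow w ((2 ℕ.* p / 2) ℕ.^ 2)
          * Uβ 0 (m ℕ.+ 2 ℕ.* p / 2) z w (ι ((+ (2 ℕ.* p)) ℚ./ 2)) b₂
  Uβ-at-even p m b₂ z w = begin
    Uβ (2 ℕ.* p) m z w 0# b₂
      ≈⟨ U-at-param-0 (2 ℕ.* p) m p (p ℕ.+ m) (param b₂) z w
                   (filter-odd?-nm-set-2* p m) (filter-even?-nm-set-2* p m) (λ {k} _ → sign k) ⟩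
    shape (p ℕ.^ 2) (p ℕ.+ m) (fromℕ p)
      ≡⟨ cong₂ (λ e M → shape e M (fromℕ p)) (cong (ℕ._^ 2) (sym (2*n/2≡n p)))
                                          (trans (ℕP.+-comm p m) (cong (m ℕ.+_) (sym (2*n/2≡n p)))) ⟩
    shape ((2 ℕ.* p / 2) ℕ.^ 2) (m ℕ.+ 2 ℕ.* p / 2) (fromℕ p)
      ≡⟨ cong (shape ((2 ℕ.* p / 2) ℕ.^ 2) (m ℕ.+ 2 ℕ.* p / 2)) (sym (frac-2* p)) ⟩
    shape ((2 ℕ.* p / 2) ℕ.^ 2) (m ℕ.+ 2 ℕ.* p / 2) ((+ (2 ℕ.* p)) ℚ./ 2) ∎
    where
    shape : ℕ → ℕ → ℚ → Carrier
    shape e M x = seqA-set (param b₂) (odd-part (2 ℕ.* p) m) * pow w e * Uβ 0 M z w (ι x) b₂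
    sign : ∀ k → (2 ℕ.* suc k ∸ 2 ℕ.* p) / 2 ≡ suc k ∸ p
    sign k = trans (cong (_/ 2) (sym (ℕP.*-distribˡ-∸ 2 (suc k) p))) (2*n/2≡n (suc k ∸ p))

  Uβ-at-odd : ∀ p m b₂ z w → let n = suc (2 ℕ.* p) in
    Uβ n m z w 0# b₂
      ≈ seqA-set (param b₂) (odd-part n m) * pow w (((n ℕ.+ 2 ℕ.* m ℕ.+ 1) / 2) ℕ.^ 2)
          * Uβ 0 ((n ∸ 1) / 2) z w (ι ((+ (2 ℕ.* m ℕ.+ n ℕ.+ 1)) ℚ./ 2)) b₂
  Uβ-at-odd p m b₂ z w = begin
    Uβ n m z w 0# b₂
      ≈⟨ U-at-param-0 n m P p (param b₂) z w
                   (filter-odd?-nm-set-1+2* p m) (filter-even?-nm-set-1+2* p m) sign ⟩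
    shape (P ℕ.^ 2) p (fromℕ P)
      ≡⟨ cong₂ (λ e M → shape e M (fromℕ P)) (cong (ℕ._^ 2) (sym P≡)) (sym (2*n/2≡n p)) ⟩
    shape (((n ℕ.+ 2 ℕ.* m ℕ.+ 1) / 2) ℕ.^ 2) ((n ∸ 1) / 2) (fromℕ P)
      ≡⟨ cong (shape (((n ℕ.+ 2 ℕ.* m ℕ.+ 1) / 2) ℕ.^ 2) ((n ∸ 1) / 2))
              (sym (trans (cong (λ x → frac x 2) (2m+n+1≡ p m)) (frac-2* P))) ⟩
    shape (((n ℕ.+ 2 ℕ.* m ℕ.+ 1) / 2) ℕ.^ 2) ((n ∸ 1) / 2) ((+ (2 ℕ.* m ℕ.+ n ℕ.+ 1)) ℚ./ 2) ∎
    where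
    n = suc (2 ℕ.* p)
    P = p ℕ.+ suc m
    shape : ℕ → ℕ → ℚ → Carrier
    shape e M x = seqA-set (param b₂) (odd-part n m) * pow w e * Uβ 0 M z w (ι x) b₂
    n+2m+1≡ : ∀ p m → suc (2 ℕ.* p) ℕ.+ 2 ℕ.* m ℕ.+ 1 ≡ 2 ℕ.* (p ℕ.+ suc m)
    n+2m+1≡ = solve-∀
    2m+n+1≡ : ∀ p m → 2 ℕ.* m ℕ.+ suc (2 ℕ.* p) ℕ.+ 1 ≡ 2 ℕ.* (p ℕ.+ suc m)
    2m+n+1≡ = solve-∀
    P≡ : (n ℕ.+ 2 ℕ.* m ℕ.+ 1) / 2 ≡ P
    P≡ = trans (cong (_/ 2) (n+2m+1≡ p m)) (2*n/2≡n P)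
    sign : ∀ {k} → k < p → (2 ℕ.* suc k ∸ n) / 2 ≡ suc k ∸ P
    sign {k} k<p = trans (cong (_/ 2) (ℕP.m≤n⇒m∸n≡0 (ℕP.≤-trans (ℕP.*-monoʳ-≤ 2 k<p) (ℕP.n≤1+n (2 ℕ.* p)))))
                         (sym (ℕP.m≤n⇒m∸n≡0 (ℕP.≤-trans k<p (ℕP.m≤m+n p (suc m)))))

lemma4p7 : ∀ {c ℓ} (R : CommutativeRing c ℓ) (ι : ℚ → CommutativeRing.Carrier R) →
    IsℚAlgebraMap R ι →
    ∀ (n m : ℕ) (b₂ z w : CommutativeRing.Carrier R) →
    let open CommutativeRing R
        open Umemura R ι
        bset = seqA-set (param b₂) (odd-part n m)
    in (n % 2 ≡ 0 →
          Uβ n m z w 0# b₂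
            ≈ bset * pow w ((n / 2) ℕ.^ 2)
                   * Uβ 0 (m ℕ.+ n / 2) z w (ι ((+ n) Data.Rational./ 2)) b₂)
     × (n % 2 ≡ 1 →
          Uβ n m z w 0# b₂
            ≈ bset * pow w (((n ℕ.+ 2 ℕ.* m ℕ.+ 1) / 2) ℕ.^ 2)
                   * Uβ 0 ((n ℕ.∸ 1) / 2) z w (ι ((+ (2 ℕ.* m ℕ.+ n ℕ.+ 1)) Data.Rational./ 2)) b₂)
lemma4p7 R ι ι-hom n m b₂ z w with parity n
... | even p = (λ _ → Uβ-at-even R ι ι-hom p m b₂ z w)
             , (λ 2p%2≡1 → ⊥-elim (2*n%2≢1 p 2p%2≡1))
... | odd p  = (λ [1+2p]%2≡0 → ⊥-elim (ℕP.1+n≢0 (trans (sym ([1+2*n]%2≡1 p)) [1+2p]%2≡0)))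
             , (λ _ → Uβ-at-odd R ι ι-hom p m b₂ z w)
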